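{- Let $n\ge 1$ and $\pi=\pi_1\cdots\pi_n\in\mathcal{S}_n$. For each $i$ let $(c_i,r_i)$ be the cell of $\pi_i$ (defined in the context), and let $S=\{(c,r)\in\mathbb{Z}_{>0}^2:\ \exists i\le n \text{ with } c\le c_i \text{ and } r\le r_i\}$ be the set of shaded and eliminated cells of $\pi$. For $m\in\{1,\dots,n+1\}$ let $\pi^{(m)}\in\mathcal{S}_{n+1}$ be the permutation obtained by appending $m$ to $\pi$ (as defined in the context), and let $(c,r)$ be the cell of its last entry. Then $(c,r)$ is an open cell (i.e. $(c,r)\notin S$) that is edge-adjacent to $S$, i.e. $(c-1,r)\in S$ or $(c,r-1)\in S$. Moreover, every cell $(c,r)\in\mathbb{Z}_{>0}^2\setminus S$ that is edge-adjacent to $S$ is the cell of the last entry of $\pi^{(m)}$ for some $m\in\{1,\dots,n+1\}$.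
   Context: $\mathcal{S}_n$ is the set of permutations of $\{1,\dots,n\}$, written in one-line notation. Appending $m\in\{1,\dots,n+1\}$ to $\pi\in\mathcal{S}_n$ produces $\pi'=\pi'_1\cdots\pi'_n m\in\mathcal{S}_{n+1}$, where $\pi'_i=\pi_i$ if $\pi_i\le m-1$ and $\pi'_i=\pi_i+1$ if $\pi_i\ge m$ (so the first $n$ entries keep their relative order). For a permutation $\sigma=\sigma_1\cdots\sigma_N$ and an index $i$, the cell of $\sigma_i$ is the ordered pair $(c,r)$ where $c$ is the length of the longest increasing subsequence of $\sigma$ ending at $\sigma_i$ and $r$ is the length of the longest decreasing subsequence of $\sigma$ ending at $\sigma_i$; $c$ is called the column and $r$ the row of the cell. -}

module Defs where

open import Data.Nat using (ℕ; zero; suc; _≤_; _<_; _>_; _∸_; _≤ᵇ_)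
open import Data.Fin using (Fin; toℕ; fromℕ) renaming (_<_ to _<ᶠ_)
open import Data.Fin.Permutation using (Permutation′; _⟨$⟩ʳ_)
open import Data.Vec.Functional using (insertAt)
open import Data.Bool using (if_then_else_)
open import Data.Product using (Σ; ∃; _×_; _,_)
open import Data.Sum using (_⊎_)
open import Relation.Binary.PropositionalEquality using (_≡_)

Seq : ℕ → Set
Seq N = Fin N → ℕ

oneLine : ∀ {n} → Permutation′ n → Seq n
oneLine π i = suc (toℕ (π ⟨$⟩ʳ i))

SubseqEndingAt : ∀ {N} → (ℕ → ℕ → Set) → Seq N → Fin N → ℕ → Set
SubseqEndingAt {N} R σ i zero = Data.Empty.⊥
  where import Data.Empty
SubseqEndingAt {N} R σ i (suc l) =
  Σ (Fin (suc l) → Fin N) λ idx →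
    ((a b : Fin (suc l)) → a <ᶠ b → (idx a <ᶠ idx b) × R (σ (idx a)) (σ (idx b)))
    × idx (fromℕ l) ≡ i

IsLongestEndingAt : ∀ {N} → (ℕ → ℕ → Set) → Seq N → Fin N → ℕ → Set
IsLongestEndingAt R σ i k =
  SubseqEndingAt R σ i k × (∀ k′ → SubseqEndingAt R σ i k′ → k′ ≤ k)

IsCell : ∀ {N} → Seq N → Fin N → ℕ → ℕ → Set
IsCell σ i c r = IsLongestEndingAt _<_ σ i c × IsLongestEndingAt _>_ σ i r

InS : ∀ {N} → Seq N → ℕ → ℕ → Set
InS {N} σ c r =
  1 ≤ c × 1 ≤ r ×
  (∃ λ (i : Fin N) → ∃ λ cᵢ → ∃ λ rᵢ → IsCell σ i cᵢ rᵢ × c ≤ cᵢ × r ≤ rᵢ)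

-- (c , r) is edge-adjacent to S: (c-1 , r) ∈ S or (c , r-1) ∈ S.
-- (When c = 1 or r = 1, c ∸ 1 = 0 resp. r ∸ 1 = 0, which is never in S.)
AdjacentToS : ∀ {N} → Seq N → ℕ → ℕ → Set
AdjacentToS σ c r = InS σ (c ∸ 1) r ⊎ InS σ c (r ∸ 1)

shiftFrom : ℕ → ℕ → ℕ
shiftFrom m v = if suc v ≤ᵇ m then v else suc v

append : ∀ {n} → Seq n → ℕ → Seq (suc n)
append {n} σ m = insertAt (λ i → shiftFrom m (σ i)) (fromℕ n) m

{-# OPTIONS --safe #-}

-- Appending m keeps the first n entries in their relative order and places exactly the entries
-- π_j < m below the new last entry, so its cell is (1 + max {c_j : π_j < m}, 1 + max {r_j : π_j ≥ m}).
-- No (c_i, r_i) dominates it, since π_i < m bounds c_i and π_i ≥ m bounds r_i; comparing the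
-- positions of the two maximisers shows that one of them dominates a neighbour of the cell.
-- Conversely, an open cell (c, r) separates the entries: every entry with c ≤ c_i lies above every
-- entry with r ≤ r_j. If (c-1, r) ∈ S, put m just above the highest entry with r ≤ r_j; if
-- (c, r-1) ∈ S, put m at the lowest entry with c ≤ c_i. The maximum not witnessed by the adjacent
-- cell is attained one step before that extreme entry on a longest monotone chain ending there.
module Submission where

open import Defs
open import Data.Nat using (ℕ; zero; suc; _≤_; _<_; _>_; z≤n; s≤s; _≤ᵇ_)
open import Data.Nat.Properties
open import Data.Fin using (Fin; zero; suc; toℕ; fromℕ; fromℕ<; inject₁) renaming (_<_ to _<ᶠ_)
import Data.Fin.Properties as Fin
open import Data.Fin.Relation.Unary.Top using (view; ‵fromℕ; ‵inject₁)
open import Data.Fin.Permutation using (Permutation′; _⟨$⟩ʳ_)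
open import Data.Vec.Functional using (insertAt)
open import Data.Vec.Functional.Properties using (insertAt-lookup)
open import Data.Bool using (true; false)
open import Data.Product using (∃; _×_; _,_; proj₁; proj₂; map; map₂)
open import Data.Sum using (_⊎_; inj₁; inj₂)
open import Data.Empty using (⊥; ⊥-elim)
open import Function using (_∘_; id; _⇔_; mk⇔; Equivalence; Injection)
open import Function.Properties.Inverse using (↔⇒↣)
open import Relation.Nullary using (¬_; Dec; yes; no)
open import Relation.Nullary.Reflects using (ofʸ; ofⁿ)
open import Relation.Binary using (TotalPreorder; Transitive; Decidable; tri<; tri≈; tri>)
import Relation.Binary.Construct.Flip.EqAndOrd as Flip
open import Relation.Binary.PropositionalEquality using (_≡_; refl; sym; subst; subst₂)

private variable
  N k l m v w : ℕ

insertAt-inject₁ : ∀ {A : Set} (xs : Fin N → A) (x : A) (j : Fin N) →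
                   insertAt xs (fromℕ N) x (inject₁ j) ≡ xs j
insertAt-inject₁ xs x zero    = refl
insertAt-inject₁ xs x (suc j) = insertAt-inject₁ (xs ∘ suc) x j

inject₁-<⁺ : {i j : Fin N} → i <ᶠ j → inject₁ i <ᶠ inject₁ j
inject₁-<⁺ {i = i} {j} = subst₂ _<_ (sym (Fin.toℕ-inject₁ i)) (sym (Fin.toℕ-inject₁ j))

inject₁-<⁻ : {i j : Fin N} → inject₁ i <ᶠ inject₁ j → i <ᶠ j
inject₁-<⁻ {i = i} {j} = subst₂ _<_ (Fin.toℕ-inject₁ i) (Fin.toℕ-inject₁ j)

inject₁<fromℕ : (i : Fin N) → inject₁ i <ᶠ fromℕ N
inject₁<fromℕ {N} i = subst (toℕ (inject₁ i) <_) (sym (Fin.toℕ-fromℕ N)) (Fin.inject₁ℕ< i)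

module _ {a ℓ₁ ℓ₂} (O : TotalPreorder a ℓ₁ ℓ₂) where
  open TotalPreorder O using (Carrier; _≲_; total) renaming (refl to ≲-refl; trans to ≲-trans)

  argmin : {P : Fin N → Set} → (∀ j → Dec (P j)) → (f : Fin N → Carrier) →
           (∀ j → ¬ P j) ⊎ ∃ λ j → P j × ∀ k → P k → f j ≲ f k
  argmin {zero}  P? f = inj₁ λ ()
  argmin {suc N} P? f with argmin (P? ∘ suc) (f ∘ suc) | P? zero
  ... | inj₁ none | no ¬p₀ = inj₁ λ { zero → ¬p₀ ; (suc k) → none k }
  ... | inj₁ none | yes p₀ =
    inj₂ (zero , p₀ , λ { zero _ → ≲-refl ; (suc k) p → ⊥-elim (none k p) })
  ... | inj₂ (j , p , min) | no ¬p₀ =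
    inj₂ (suc j , p , λ { zero p₀ → ⊥-elim (¬p₀ p₀) ; (suc k) → min k })
  ... | inj₂ (j , p , min) | yes p₀ with total (f zero) (f (suc j))
  ...   | inj₁ f₀≲fj =
    inj₂ (zero , p₀ , λ { zero _ → ≲-refl ; (suc k) p → ≲-trans f₀≲fj (min k p) })
  ...   | inj₂ fj≲f₀ = inj₂ (suc j , p , λ { zero _ → fj≲f₀ ; (suc k) → min k })

≥-totalPreorder : TotalPreorder _ _ _
≥-totalPreorder = Flip.totalPreorder ≤-totalPreorder

-- The maximum of the empty family is taken to be 0.
IsMax : (Fin N → Set) → (Fin N → ℕ) → ℕ → Set
IsMax P f M = (∀ j → P j → f j ≤ M) × (M ≡ 0 ⊎ ∃ λ j → P j × f j ≡ M)

max-exists : {P : Fin N → Set} → (∀ j → Dec (P j)) → (f : Fin N → ℕ) → ∃ (IsMax P f)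
max-exists P? f with argmin ≥-totalPreorder P? f
... | inj₁ none           = 0 , (λ j p → ⊥-elim (none j p)) , inj₁ refl
... | inj₂ (j , p , max) = f j , max , inj₂ (j , p , refl)

isMax-resp : {P Q : Fin N → Set} {f : Fin N → ℕ} {M : ℕ} →
             (∀ {j} → P j → Q j) → (∀ {j} → Q j → P j) → IsMax P f M → IsMax Q f M
isMax-resp P⇒Q Q⇒P (bound , inj₁ M≡0)            = (λ j → bound j ∘ Q⇒P) , inj₁ M≡0
isMax-resp P⇒Q Q⇒P (bound , inj₂ (j , p , fj≡M)) =
  (λ j → bound j ∘ Q⇒P) , inj₂ (j , P⇒Q p , fj≡M)

sub-reindex : ∀ {N N′} {R R′ : ℕ → ℕ → Set} {σ : Seq N} {σ′ : Seq N′} {i}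
              (g : Fin N → Fin N′) →
              (∀ {a b} → a <ᶠ b → g a <ᶠ g b) →
              (∀ {a b} → R (σ a) (σ b) → R′ (σ′ (g a)) (σ′ (g b))) →
              SubseqEndingAt R σ i k → SubseqEndingAt R′ σ′ (g i) k
sub-reindex {k = suc l} g g-mono g-R (idx , mono , refl) =
  g ∘ idx , (λ a b a<b → map g-mono g-R (mono a b a<b)) , refl

module Subsequences {R : ℕ → ℕ → Set} (R-trans : Transitive R) where

  Sub : Seq N → Fin N → ℕ → Set
  Sub = SubseqEndingAt R

  Longest : Seq N → Fin N → ℕ → Set
  Longest = IsLongestEndingAt R

  sub-one : (σ : Seq N) (i : Fin N) → Sub σ i 1
  sub-one σ i = (λ _ → i) , (λ { zero zero () }) , refl

  sub-snoc : {σ : Seq N} {i j : Fin N} → Sub σ j k → j <ᶠ i → R (σ j) (σ i) → Sub σ i (suc k)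
  sub-snoc {N = N} {k = suc l} {σ = σ} {i = i} (idx , mono , refl) j<i Rji =
    idx′ , mono′ , insertAt-lookup idx (fromℕ (suc l)) i
    where
    idx′ : Fin (suc (suc l)) → Fin N
    idx′ = insertAt idx (fromℕ (suc l)) i

    below-i : ∀ a → idx a <ᶠ i × R (σ (idx a)) (σ i)
    below-i a with view a
    ... | ‵fromℕ      = j<i , Rji
    ... | ‵inject₁ a′ = map (λ a<j → <-trans a<j j<i) (λ Raj → R-trans Raj Rji)
                            (mono (inject₁ a′) (fromℕ l) (inject₁<fromℕ a′))

    mono′ : ∀ a b → a <ᶠ b → idx′ a <ᶠ idx′ b × R (σ (idx′ a)) (σ (idx′ b))
    mono′ a b a<b with view a | view b
    ... | ‵fromℕ      | _ = ⊥-elim (<⇒≱ a<b (Fin.≤fromℕ b))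
    ... | ‵inject₁ a′ | ‵fromℕ
      rewrite insertAt-inject₁ idx i a′ | insertAt-lookup idx (fromℕ (suc l)) i = below-i a′
    ... | ‵inject₁ a′ | ‵inject₁ b′
      rewrite insertAt-inject₁ idx i a′ | insertAt-inject₁ idx i b′ =
        mono a′ b′ (inject₁-<⁻ a<b)

  sub-unsnoc : {σ : Seq N} {i : Fin N} → Sub σ i (suc (suc l)) →
               ∃ λ j → j <ᶠ i × R (σ j) (σ i) × Sub σ j (suc l)
  sub-unsnoc {l = l} (idx , mono , refl) =
    let (j<i , Rji) = mono (inject₁ (fromℕ l)) (fromℕ (suc l)) (inject₁<fromℕ (fromℕ l))
    in idx (inject₁ (fromℕ l)) , j<i , Rji
     , idx ∘ inject₁ , (λ a b a<b → mono (inject₁ a) (inject₁ b) (inject₁-<⁺ a<b)) , refl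

  sub-inject₁⁻ : (τ : Seq (suc N)) {j : Fin N} → Sub τ (inject₁ j) k → Sub (τ ∘ inject₁) j k
  sub-inject₁⁻ {k = suc l} τ = go l
    where
    -- Recursing on an explicit length lets the termination checker see through the two `with`s.
    go : ∀ l {j} → Sub τ (inject₁ j) (suc l) → Sub (τ ∘ inject₁) j (suc l)
    go zero    _ = sub-one (τ ∘ inject₁) _
    go (suc l) s with sub-unsnoc {σ = τ} s
    ... | j′ , j′<j , Rj′j , s′ with view j′
    ...   | ‵fromℕ      = ⊥-elim (<⇒≱ j′<j (Fin.≤fromℕ _))
    ...   | ‵inject₁ j″ = sub-snoc {σ = τ ∘ inject₁} (go l s′) (inject₁-<⁻ j′<j) Rj′j

  longest-unique : {σ : Seq N} {i : Fin N} {k k′ : ℕ} →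
                   Longest σ i k → Longest σ i k′ → k ≡ k′
  longest-unique (s , max) (s′ , max′) = ≤-antisym (max′ _ s) (max _ s′)

  longest-positive : {σ : Seq N} {i : Fin N} → Longest σ i k → 1 ≤ k
  longest-positive {k = suc _} _ = s≤s z≤n

  longest-< : {σ : Seq N} {i j : Fin N} {kᵢ kⱼ : ℕ} → Longest σ j kⱼ → Longest σ i kᵢ →
              j <ᶠ i → R (σ j) (σ i) → kⱼ < kᵢ
  longest-< (s , _) (_ , max) j<i Rji = max _ (sub-snoc s j<i Rji)

  longest-relabel : {σ σ′ : Seq N} {i : Fin N} →
                    (∀ {a b} → R (σ a) (σ b) → R (σ′ a) (σ′ b)) →
                    (∀ {a b} → R (σ′ a) (σ′ b) → R (σ a) (σ b)) →
                    Longest σ i k → Longest σ′ i k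
  longest-relabel ⇒ ⇐ (s , max) = sub-reindex id id ⇒ s , λ k′ → max k′ ∘ sub-reindex id id ⇐

  longest-inject₁ : (τ : Seq (suc N)) {j : Fin N} →
                    Longest (τ ∘ inject₁) j k → Longest τ (inject₁ j) k
  longest-inject₁ τ (s , max) =
    sub-reindex inject₁ inject₁-<⁺ id s , λ k′ → max k′ ∘ sub-inject₁⁻ τ

  longest-last : (τ : Seq (suc N)) (L : Fin N → ℕ) {M : ℕ} →
                 (∀ j → Longest τ (inject₁ j) (L j)) →
                 IsMax (λ j → R (τ (inject₁ j)) (τ (fromℕ N))) L M → Longest τ (fromℕ N) (suc M)
  longest-last {N} τ L {M} longest (bound , attained) = reach attained , max
    where
    reach : M ≡ 0 ⊎ ∃ (λ j → R (τ (inject₁ j)) (τ (fromℕ N)) × L j ≡ M) →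
            Sub τ (fromℕ N) (suc M)
    reach (inj₁ M≡0)             = subst (Sub τ _ ∘ suc) (sym M≡0) (sub-one τ _)
    reach (inj₂ (j , Rj , Lj≡M)) =
      subst (Sub τ _ ∘ suc) Lj≡M (sub-snoc {σ = τ} (proj₁ (longest j)) (inject₁<fromℕ j) Rj)

    max : ∀ k → Sub τ (fromℕ N) k → k ≤ suc M
    max (suc zero)    _ = s≤s z≤n
    max (suc (suc l)) s with sub-unsnoc {σ = τ} s
    ... | j′ , j′<last , Rj′ , s′ with view j′
    ...   | ‵fromℕ     = ⊥-elim (<-irrefl refl j′<last)
    ...   | ‵inject₁ j = s≤s (≤-trans (proj₂ (longest j) _ s′) (bound j Rj′))

  longest-exists : Decidable R → (σ : Seq N) (i : Fin N) → ∃ (Longest σ i)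
  longest-exists {suc N} R? σ i with view i
  ... | ‵inject₁ j = map₂ (longest-inject₁ σ) (longest-exists R? (σ ∘ inject₁) j)
  ... | ‵fromℕ     =
    let M , isMax = max-exists (λ j → R? (σ (inject₁ j)) (σ (fromℕ N))) L
    in suc M , longest-last σ L (longest-inject₁ σ ∘ proj₂ ∘ prefix) isMax
    where
    prefix : ∀ j → ∃ (Longest (σ ∘ inject₁) j)
    prefix = longest-exists R? (σ ∘ inject₁)

    L : Fin N → ℕ
    L = proj₁ ∘ prefix

  -- The maximum is attained one step before b on a longest chain ending at b.
  isMax-predecessors : {σ : Seq N} (L : Fin N → ℕ) (b : Fin N) → (∀ j → Longest σ j (L j)) →
                       (∀ j → R (σ j) (σ b) → L j ≤ k) → k < L b →
                       IsMax (λ j → R (σ j) (σ b)) L k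
  isMax-predecessors {k = zero}  L b longest bound _ = bound , inj₁ refl
  isMax-predecessors {k = suc k} {σ} L b longest bound k<Lb with L b | longest b | k<Lb
  ... | _ | (s , _) | s≤s (s≤s k≤l) with sub-unsnoc {σ = σ} s
  ...   | j , _ , Rjb , s′ =
    bound , inj₂ (j , Rjb , ≤-antisym (bound j Rjb)
                                      (≤-trans (s≤s k≤l) (proj₂ (longest j) _ s′)))

shiftFrom-cases : ∀ m v → (v < m × shiftFrom m v ≡ v) ⊎ (m ≤ v × shiftFrom m v ≡ suc v)
shiftFrom-cases m v with suc v ≤ᵇ m | ≤ᵇ-reflects-≤ (suc v) m
... | true  | ofʸ v<m = inj₁ (v<m , refl)
... | false | ofⁿ v≮m = inj₂ (≮⇒≥ v≮m , refl)

shiftFrom-strictMono : ∀ m → v < w → shiftFrom m v < shiftFrom m w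
shiftFrom-strictMono {v = v} {w = w} m v<w with shiftFrom-cases m v | shiftFrom-cases m w
... | inj₁ (_ , p)   | inj₁ (_ , q)   rewrite p | q = v<w
... | inj₁ (_ , p)   | inj₂ (_ , q)   rewrite p | q = m<n⇒m<1+n v<w
... | inj₂ (m≤v , _) | inj₁ (w<m , _) = ⊥-elim (<⇒≱ (<-trans v<w w<m) m≤v)
... | inj₂ (_ , p)   | inj₂ (_ , q)   rewrite p | q = s≤s v<w

shiftFrom-cancel-< : ∀ m → shiftFrom m v < shiftFrom m w → v < w
shiftFrom-cancel-< {v = v} {w = w} m p with <-cmp v w
... | tri< v<w _ _  = v<w
... | tri≈ _ refl _ = ⊥-elim (<-irrefl refl p)
... | tri> _ _ w<v  = ⊥-elim (<-asym p (shiftFrom-strictMono m w<v))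

shiftFrom-<-⇔ : shiftFrom m v < m ⇔ v < m
shiftFrom-<-⇔ {m} {v} with shiftFrom-cases m v
... | inj₁ (_ , eq)   rewrite eq = mk⇔ id id
... | inj₂ (m≤v , eq) rewrite eq = mk⇔ (λ v+1<m → ⊥-elim (<⇒≱ v+1<m (m≤n⇒m≤1+n m≤v)))
                                        (λ v<m → ⊥-elim (<⇒≱ v<m m≤v))

shiftFrom->-⇔ : shiftFrom m v > m ⇔ m ≤ v
shiftFrom->-⇔ {m} {v} with shiftFrom-cases m v
... | inj₁ (v<m , eq) rewrite eq = mk⇔ (λ m<v → ⊥-elim (<-asym m<v v<m))
                                        (λ m≤v → ⊥-elim (<⇒≱ v<m m≤v))
... | inj₂ (_ , eq)   rewrite eq = mk⇔ ≤-pred s≤s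

module Increasing = Subsequences {_<_} <-trans
module Decreasing = Subsequences {_>_} (λ p q → <-trans q p)

module Cells {n : ℕ} (σ : Seq n) where

  col row : Fin n → ℕ
  col = proj₁ ∘ Increasing.longest-exists _<?_ σ
  row = proj₁ ∘ Decreasing.longest-exists _>?_ σ

  col-longest : ∀ j → Increasing.Longest σ j (col j)
  col-longest = proj₂ ∘ Increasing.longest-exists _<?_ σ

  row-longest : ∀ j → Decreasing.Longest σ j (row j)
  row-longest = proj₂ ∘ Decreasing.longest-exists _>?_ σ

  col-positive : ∀ j → 1 ≤ col j
  col-positive j = Increasing.longest-positive (col-longest j)

  row-positive : ∀ j → 1 ≤ row j
  row-positive j = Decreasing.longest-positive (row-longest j)

  col-< : {i j : Fin n} → j <ᶠ i → σ j < σ i → col j < col i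
  col-< j<i = Increasing.longest-< (col-longest _) (col-longest _) j<i

  row-< : {i j : Fin n} → j <ᶠ i → σ j > σ i → row j < row i
  row-< j<i = Decreasing.longest-< (row-longest _) (row-longest _) j<i

  InS-intro : ∀ {c r} i → 1 ≤ c → 1 ≤ r → c ≤ col i → r ≤ row i → InS σ c r
  InS-intro i 1≤c 1≤r c≤colᵢ r≤rowᵢ =
    1≤c , 1≤r , i , col i , row i , (col-longest i , row-longest i) , c≤colᵢ , r≤rowᵢ

  InS-elim : ∀ {c r} → InS σ c r → ∃ λ i → c ≤ col i × r ≤ row i
  InS-elim {c} {r} (_ , _ , i , cᵢ , rᵢ , (cᵢ-longest , rᵢ-longest) , c≤cᵢ , r≤rᵢ) =
    i , subst (c ≤_) (Increasing.longest-unique cᵢ-longest (col-longest i)) c≤cᵢ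
      , subst (r ≤_) (Decreasing.longest-unique rᵢ-longest (row-longest i)) r≤rᵢ

  module Appended (m : ℕ) where
    τ : Seq (suc n)
    τ = append σ m

    τ-inject₁ : ∀ j → τ (inject₁ j) ≡ shiftFrom m (σ j)
    τ-inject₁ = insertAt-inject₁ (shiftFrom m ∘ σ) m

    τ-last : τ (fromℕ n) ≡ m
    τ-last = insertAt-lookup (shiftFrom m ∘ σ) (fromℕ n) m

    τ-<⁺ : ∀ {a b} → σ a < σ b → τ (inject₁ a) < τ (inject₁ b)
    τ-<⁺ {a} {b} = subst₂ _<_ (sym (τ-inject₁ a)) (sym (τ-inject₁ b)) ∘ shiftFrom-strictMono m

    τ-<⁻ : ∀ {a b} → τ (inject₁ a) < τ (inject₁ b) → σ a < σ b
    τ-<⁻ {a} {b} = shiftFrom-cancel-< m ∘ subst₂ _<_ (τ-inject₁ a) (τ-inject₁ b)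

    τ-<-last : ∀ {j} → τ (inject₁ j) < τ (fromℕ n) ⇔ σ j < m
    τ-<-last {j} rewrite τ-inject₁ j | τ-last = shiftFrom-<-⇔

    τ->-last : ∀ {j} → τ (inject₁ j) > τ (fromℕ n) ⇔ m ≤ σ j
    τ->-last {j} rewrite τ-inject₁ j | τ-last = shiftFrom->-⇔

    col-τ : ∀ j → Increasing.Longest τ (inject₁ j) (col j)
    col-τ j = Increasing.longest-inject₁ τ (Increasing.longest-relabel τ-<⁺ τ-<⁻ (col-longest j))

    row-τ : ∀ j → Decreasing.Longest τ (inject₁ j) (row j)
    row-τ j = Decreasing.longest-inject₁ τ (Decreasing.longest-relabel τ-<⁺ τ-<⁻ (row-longest j))

  appended-cell : ∀ m {Mc Mr} →
                  IsMax (λ j → σ j < m) col Mc → IsMax (λ j → m ≤ σ j) row Mr →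
                  IsCell (append σ m) (fromℕ n) (suc Mc) (suc Mr)
  appended-cell m maxc maxr =
      Increasing.longest-last τ col col-τ (isMax-resp (from τ-<-last) (to τ-<-last) maxc)
    , Decreasing.longest-last τ row row-τ (isMax-resp (from τ->-last) (to τ->-last) maxr)
    where open Appended m
          open Equivalence

  appended-cell-open : ∀ {m Mc Mr} →
                       IsMax (λ j → σ j < m) col Mc → IsMax (λ j → m ≤ σ j) row Mr →
                       ¬ InS σ (suc Mc) (suc Mr)
  appended-cell-open {m} (colBound , _) (rowBound , _) s with InS-elim s
  ... | i , Mc<colᵢ , Mr<rowᵢ with σ i <? m
  ...   | yes σᵢ<m = <⇒≱ Mc<colᵢ (colBound i σᵢ<m)
  ...   | no  σᵢ≮m = <⇒≱ Mr<rowᵢ (rowBound i (≮⇒≥ σᵢ≮m))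

  appended-cell-adjacent : ∀ {m Mc Mr} → Fin n →
                           IsMax (λ j → σ j < m) col Mc → IsMax (λ j → m ≤ σ j) row Mr →
                           AdjacentToS σ (suc Mc) (suc Mr)
  appended-cell-adjacent {m} j₀ (colBound , inj₁ refl) (rowBound , inj₁ refl) with σ j₀ <? m
  ... | yes σj₀<m = ⊥-elim (<⇒≱ (col-positive j₀) (colBound j₀ σj₀<m))
  ... | no  σj₀≮m = ⊥-elim (<⇒≱ (row-positive j₀) (rowBound j₀ (≮⇒≥ σj₀≮m)))
  appended-cell-adjacent _ (_ , inj₁ refl) (_ , inj₂ (k , _ , refl)) =
    inj₂ (InS-intro k ≤-refl (row-positive k) (col-positive k) ≤-refl)
  appended-cell-adjacent _ (_ , inj₂ (j , _ , refl)) (_ , inj₁ refl) =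
    inj₁ (InS-intro j (col-positive j) ≤-refl ≤-refl (row-positive j))
  appended-cell-adjacent _ (_ , inj₂ (j , σj<m , refl)) (_ , inj₂ (k , m≤σk , refl))
    with Fin.<-cmp j k
  ... | tri< j<k _ _  =
    inj₂ (InS-intro k (s≤s z≤n) (row-positive k) (col-< j<k (<-≤-trans σj<m m≤σk)) ≤-refl)
  ... | tri≈ _ refl _ = ⊥-elim (<⇒≱ σj<m m≤σk)
  ... | tri> _ _ k<j  =
    inj₁ (InS-intro j (col-positive j) (s≤s z≤n) ≤-refl (row-< k<j (<-≤-trans σj<m m≤σk)))

  appended-cell-open-adjacent : Fin n → ∀ m →
    ∃ λ c → ∃ λ r → IsCell (append σ m) (fromℕ n) c r × ¬ InS σ c r × AdjacentToS σ c r
  appended-cell-open-adjacent j₀ m =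
    let Mc , maxc = max-exists (λ j → σ j <? m) col
        Mr , maxr = max-exists (λ j → m ≤? σ j) row
    in suc Mc , suc Mr , appended-cell m maxc maxr
     , appended-cell-open maxc maxr , appended-cell-adjacent j₀ maxc maxr

  module OpenCell (σ-injective : ∀ {i j} → σ i ≡ σ j → i ≡ j)
                  {c r : ℕ} (notInS : ¬ InS σ (suc c) (suc r)) where

    undominated : ∀ {i} → c < col i → r < row i → ⊥
    undominated {i} c<colᵢ r<rowᵢ = notInS (InS-intro i (s≤s z≤n) (s≤s z≤n) c<colᵢ r<rowᵢ)

    separated : ∀ {i j} → c < col i → r < row j → σ j < σ i
    separated {i} {j} c<colᵢ r<rowⱼ with <-cmp (σ j) (σ i)
    ... | tri< σⱼ<σᵢ _ _ = σⱼ<σᵢ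
    ... | tri≈ _ σⱼ≡σᵢ _ rewrite σ-injective σⱼ≡σᵢ = ⊥-elim (undominated c<colᵢ r<rowⱼ)
    ... | tri> _ _ σᵢ<σⱼ with Fin.<-cmp i j
    ...   | tri< i<j _ _  = ⊥-elim (undominated (<-trans c<colᵢ (col-< i<j σᵢ<σⱼ)) r<rowⱼ)
    ...   | tri≈ _ refl _ = ⊥-elim (<-irrefl refl σᵢ<σⱼ)
    ...   | tri> _ _ j<i  = ⊥-elim (undominated c<colᵢ (<-trans r<rowⱼ (row-< j<i σᵢ<σⱼ)))

    left-adjacent-appended : InS σ c (suc r) →
                             ∃ λ b → IsCell (append σ (suc (σ b))) (fromℕ n) (suc c) (suc r)
    left-adjacent-appended s with InS-elim s
    ... | i₀ , c≤colᵢ₀ , r<rowᵢ₀ with argmin ≥-totalPreorder (λ j → r <? row j) σ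
    ...   | inj₁ none = ⊥-elim (none i₀ r<rowᵢ₀)
    ...   | inj₂ (b , r<row-b , b-max) =
      b , appended-cell (suc (σ b)) (colBound , inj₂ (i₀ , s≤s (b-max i₀ r<rowᵢ₀) , colᵢ₀≡c))
                                    (Decreasing.isMax-predecessors row b row-longest rowBound r<row-b)
      where
      colᵢ₀≡c : col i₀ ≡ c
      colᵢ₀≡c = ≤-antisym (≮⇒≥ λ c<colᵢ₀ → undominated c<colᵢ₀ r<rowᵢ₀) c≤colᵢ₀

      colBound : ∀ j → σ j < suc (σ b) → col j ≤ c
      colBound j σj≤σb = ≮⇒≥ λ c<colⱼ → <⇒≱ (separated c<colⱼ r<row-b) (≤-pred σj≤σb)

      rowBound : ∀ j → σ j > σ b → row j ≤ r
      rowBound j σb<σj = ≮⇒≥ λ r<rowⱼ → <⇒≱ σb<σj (b-max j r<rowⱼ)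

    lower-adjacent-appended : InS σ (suc c) r →
                              ∃ λ a → IsCell (append σ (σ a)) (fromℕ n) (suc c) (suc r)
    lower-adjacent-appended s with InS-elim s
    ... | k₀ , c<colₖ₀ , r≤rowₖ₀ with argmin ≤-totalPreorder (λ j → c <? col j) σ
    ...   | inj₁ none = ⊥-elim (none k₀ c<colₖ₀)
    ...   | inj₂ (a , c<col-a , a-min) =
      a , appended-cell (σ a) (Increasing.isMax-predecessors col a col-longest colBound c<col-a)
                              (rowBound , inj₂ (k₀ , a-min k₀ c<colₖ₀ , rowₖ₀≡r))
      where
      rowₖ₀≡r : row k₀ ≡ r
      rowₖ₀≡r = ≤-antisym (≮⇒≥ λ r<rowₖ₀ → undominated c<colₖ₀ r<rowₖ₀) r≤rowₖ₀

      colBound : ∀ j → σ j < σ a → col j ≤ c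
      colBound j σj<σa = ≮⇒≥ λ c<colⱼ → <⇒≱ σj<σa (a-min j c<colⱼ)

      rowBound : ∀ j → σ a ≤ σ j → row j ≤ r
      rowBound j σa≤σj = ≮⇒≥ λ r<rowⱼ → <⇒≱ (separated c<col-a r<rowⱼ) σa≤σj

oneLine-injective : ∀ {n} (π : Permutation′ n) {i j} → oneLine π i ≡ oneLine π j → i ≡ j
oneLine-injective π = Injection.injective (↔⇒↣ π) ∘ Fin.toℕ-injective ∘ suc-injective

open-adjacent-cell-appended : ∀ {n} (π : Permutation′ n) {c r} →
  ¬ InS (oneLine π) (suc c) (suc r) → AdjacentToS (oneLine π) (suc c) (suc r) →
  ∃ λ m → 1 ≤ m × m ≤ suc n × IsCell (append (oneLine π) m) (fromℕ n) (suc c) (suc r)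
open-adjacent-cell-appended π notInS (inj₁ s) =
  let b , cell = OpenCell.left-adjacent-appended (oneLine-injective π) notInS s
  in suc (oneLine π b) , s≤s z≤n , s≤s (Fin.toℕ<n (π ⟨$⟩ʳ b)) , cell
  where open Cells (oneLine π)
open-adjacent-cell-appended π notInS (inj₂ s) =
  let a , cell = OpenCell.lower-adjacent-appended (oneLine-injective π) notInS s
  in oneLine π a , s≤s z≤n , m≤n⇒m≤1+n (Fin.toℕ<n (π ⟨$⟩ʳ a)) , cell
  where open Cells (oneLine π)

proposition1 : (n : ℕ) → 1 ≤ n → (π : Permutation′ n) →
    ((m : ℕ) → 1 ≤ m → m ≤ suc n →
      ∃ λ c → ∃ λ r →
        IsCell (append (oneLine π) m) (fromℕ n) c r
        × ¬ InS (oneLine π) c r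
        × AdjacentToS (oneLine π) c r)
    × ((c r : ℕ) → 1 ≤ c → 1 ≤ r →
      ¬ InS (oneLine π) c r → AdjacentToS (oneLine π) c r →
      ∃ λ m → 1 ≤ m × m ≤ suc n × IsCell (append (oneLine π) m) (fromℕ n) c r)
proposition1 n 1≤n π =
    (λ m _ _ → Cells.appended-cell-open-adjacent (oneLine π) (fromℕ< 1≤n) m)
  , λ { _ _ (s≤s _) (s≤s _) → open-adjacent-cell-appended π }
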